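{- $\mathsf{MGrz}\vee\mathsf{GKur}=\mathsf{MGrz}\vee\mathsf{LKur}=\mathsf{MGrz}\vee\mathsf{N}$.
   Context: $\mathcal{L}_{\forall\exists}$ is the intuitionistic propositional language with modalities $\forall,\exists$; $\mathsf{MIPC}$ is the smallest set of $\mathcal{L}_{\forall\exists}$-formulas containing all intuitionistic propositional theorems, $\forall(p\wedge q)\leftrightarrow(\forall p\wedge\forall q)$, $\forall p\to p$, $\forall p\to\forall\forall p$, $\exists(p\vee q)\leftrightarrow(\exists p\vee\exists q)$, $p\to\exists p$, $\exists\exists p\to\exists p$, $(\exists p\wedge\exists q)\to\exists(\exists p\wedge q)$, $\exists\forall p\to\forall p$, $\exists p\to\forall\exists p$, closed under modus ponens, substitution and $\varphi/\forall\varphi$; $\mathsf{Kur}$ is the smallest such set also containing $\forall\neg\neg p\to\neg\neg\forall p$. $\mathsf{MS4}$ is the smallest set of formulas in the classical language with modalities $\Box,\forall$ ($\Diamond=\neg\Box\neg$, $\exists=\neg\forall\neg$) containing classical tautologies, $\mathsf{S4}$ axioms for $\Box$, $\mathsf{S5}$ axioms for $\forall$, and $\Box\forall p\to\forall\Box p$, closed under modus ponens, substitution, and necessitation for $\Box$ and $\forall$; $\mathsf{MS4}+\Gamma$ is the least such set containing $\Gamma$, and $\mathsf{M}_1\vee\mathsf{M}_2$ the least one containing both. $\mathsf{MGrz}=\mathsf{MS4}+(\Box(\Box(p\to\Box p)\to p)\to p)$, $\mathsf{LKur}=\mathsf{MS4}+(\Box\forall\Diamond\Box p\to\Diamond\forall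 p)$, $\mathsf{N}=\mathsf{MS4}+(\Box\exists p\to\Diamond\exists\Box p)$. Gödel translation: $\bot^t=\bot$, $p^t=\Box p$, $(\varphi\wedge\psi)^t=\varphi^t\wedge\psi^t$, $(\varphi\vee\psi)^t=\varphi^t\vee\psi^t$, $(\varphi\to\psi)^t=\Box(\neg\varphi^t\vee\psi^t)$, $(\forall\varphi)^t=\Box\forall\varphi^t$, $(\exists\varphi)^t=\exists\varphi^t$. $\mathsf{GKur}=\mathsf{MS4}+\{\varphi^t:\mathsf{Kur}\vdash\varphi\}$. -}

module Defs where

open import Data.Nat using (ℕ)
open import Data.Bool using (Bool; true; false; _∧_; _∨_; not)
open import Data.Product using (Σ; _×_)
open import Data.Sum using (_⊎_)
open import Relation.Binary.PropositionalEquality using (_≡_)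

infixr 5 _⇒ᵢ_
infixl 7 _∧ᵢ_
infixl 6 _∨ᵢ_

data IForm : Set where
  varᵢ : ℕ → IForm
  ⊥ᵢ   : IForm
  _∧ᵢ_ : IForm → IForm → IForm
  _∨ᵢ_ : IForm → IForm → IForm
  _⇒ᵢ_ : IForm → IForm → IForm
  Aᵢ   : IForm → IForm
  Eᵢ   : IForm → IForm

¬ᵢ_ : IForm → IForm
¬ᵢ φ = φ ⇒ᵢ ⊥ᵢ

_⇔ᵢ_ : IForm → IForm → IForm
φ ⇔ᵢ ψ = (φ ⇒ᵢ ψ) ∧ᵢ (ψ ⇒ᵢ φ)

substᵢ : (ℕ → IForm) → IForm → IForm
substᵢ σ (varᵢ n) = σ n
substᵢ σ ⊥ᵢ = ⊥ᵢ
substᵢ σ (φ ∧ᵢ ψ) = substᵢ σ φ ∧ᵢ substᵢ σ ψ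
substᵢ σ (φ ∨ᵢ ψ) = substᵢ σ φ ∨ᵢ substᵢ σ ψ
substᵢ σ (φ ⇒ᵢ ψ) = substᵢ σ φ ⇒ᵢ substᵢ σ ψ
substᵢ σ (Aᵢ φ) = Aᵢ (substᵢ σ φ)
substᵢ σ (Eᵢ φ) = Eᵢ (substᵢ σ φ)

pᵢ qᵢ : IForm
pᵢ = varᵢ 0
qᵢ = varᵢ 1

data IPCAxiom : IForm → Set where
  ax-K   : ∀ a b → IPCAxiom (a ⇒ᵢ (b ⇒ᵢ a))
  ax-S   : ∀ a b c → IPCAxiom ((a ⇒ᵢ (b ⇒ᵢ c)) ⇒ᵢ ((a ⇒ᵢ b) ⇒ᵢ (a ⇒ᵢ c)))
  ax-∧E₁ : ∀ a b → IPCAxiom ((a ∧ᵢ b) ⇒ᵢ a)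
  ax-∧E₂ : ∀ a b → IPCAxiom ((a ∧ᵢ b) ⇒ᵢ b)
  ax-∧I  : ∀ a b → IPCAxiom (a ⇒ᵢ (b ⇒ᵢ (a ∧ᵢ b)))
  ax-∨I₁ : ∀ a b → IPCAxiom (a ⇒ᵢ (a ∨ᵢ b))
  ax-∨I₂ : ∀ a b → IPCAxiom (b ⇒ᵢ (a ∨ᵢ b))
  ax-∨E  : ∀ a b c → IPCAxiom ((a ⇒ᵢ c) ⇒ᵢ ((b ⇒ᵢ c) ⇒ᵢ ((a ∨ᵢ b) ⇒ᵢ c)))
  ax-⊥E  : ∀ a → IPCAxiom (⊥ᵢ ⇒ᵢ a)

data MIPCAxiom : IForm → Set where
  m1 : MIPCAxiom (Aᵢ (pᵢ ∧ᵢ qᵢ) ⇔ᵢ (Aᵢ pᵢ ∧ᵢ Aᵢ qᵢ))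
  m2 : MIPCAxiom (Aᵢ pᵢ ⇒ᵢ pᵢ)
  m3 : MIPCAxiom (Aᵢ pᵢ ⇒ᵢ Aᵢ (Aᵢ pᵢ))
  m4 : MIPCAxiom (Eᵢ (pᵢ ∨ᵢ qᵢ) ⇔ᵢ (Eᵢ pᵢ ∨ᵢ Eᵢ qᵢ))
  m5 : MIPCAxiom (pᵢ ⇒ᵢ Eᵢ pᵢ)
  m6 : MIPCAxiom (Eᵢ (Eᵢ pᵢ) ⇒ᵢ Eᵢ pᵢ)
  m7 : MIPCAxiom ((Eᵢ pᵢ ∧ᵢ Eᵢ qᵢ) ⇒ᵢ Eᵢ (Eᵢ pᵢ ∧ᵢ qᵢ))
  m8 : MIPCAxiom (Eᵢ (Aᵢ pᵢ) ⇒ᵢ Aᵢ pᵢ)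
  m9 : MIPCAxiom (Eᵢ pᵢ ⇒ᵢ Aᵢ (Eᵢ pᵢ))

data Kur⊢_ : IForm → Set where
  ipc   : ∀ {φ} → IPCAxiom φ → Kur⊢ φ
  mipc  : ∀ {φ} → MIPCAxiom φ → Kur⊢ φ
  kur   : Kur⊢ (Aᵢ (¬ᵢ ¬ᵢ pᵢ) ⇒ᵢ ¬ᵢ ¬ᵢ Aᵢ pᵢ)
  mp    : ∀ {φ ψ} → Kur⊢ (φ ⇒ᵢ ψ) → Kur⊢ φ → Kur⊢ ψ
  sub   : ∀ {φ} (σ : ℕ → IForm) → Kur⊢ φ → Kur⊢ substᵢ σ φ
  nec∀  : ∀ {φ} → Kur⊢ φ → Kur⊢ Aᵢ φ

infixr 5 _⇒_
infixl 7 _∧'_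
infixl 6 _∨'_

data CForm : Set where
  var   : ℕ → CForm
  ⊥'    : CForm
  _∧'_  : CForm → CForm → CForm
  _∨'_  : CForm → CForm → CForm
  _⇒_   : CForm → CForm → CForm
  □     : CForm → CForm
  𝔸     : CForm → CForm

¬'_ : CForm → CForm
¬' φ = φ ⇒ ⊥'

◇ : CForm → CForm
◇ φ = ¬' □ (¬' φ)

𝔼 : CForm → CForm
𝔼 φ = ¬' 𝔸 (¬' φ)

subst : (ℕ → CForm) → CForm → CForm
subst σ (var n) = σ n
subst σ ⊥' = ⊥'
subst σ (φ ∧' ψ) = subst σ φ ∧' subst σ ψ
subst σ (φ ∨' ψ) = subst σ φ ∨' subst σ ψ
subst σ (φ ⇒ ψ) = subst σ φ ⇒ subst σ ψ
subst σ (□ φ) = □ (subst σ φ)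
subst σ (𝔸 φ) = 𝔸 (subst σ φ)

-- Classical tautologies: true under every Boolean valuation that treats
-- propositional variables and modalised formulas (□φ, ∀φ) as atoms.
eval : (CForm → Bool) → CForm → Bool
eval v (var n) = v (var n)
eval v ⊥' = false
eval v (φ ∧' ψ) = eval v φ ∧ eval v ψ
eval v (φ ∨' ψ) = eval v φ ∨ eval v ψ
eval v (φ ⇒ ψ) = not (eval v φ) ∨ eval v ψ
eval v (□ φ) = v (□ φ)
eval v (𝔸 φ) = v (𝔸 φ)

Tautology : CForm → Set
Tautology φ = (v : CForm → Bool) → eval v φ ≡ true

p q : CForm
p = var 0
q = var 1

data MS4Axiom : CForm → Set where
  □K : MS4Axiom (□ (p ⇒ q) ⇒ (□ p ⇒ □ q))
  □T : MS4Axiom (□ p ⇒ p)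
  □4 : MS4Axiom (□ p ⇒ □ (□ p))
  𝔸K : MS4Axiom (𝔸 (p ⇒ q) ⇒ (𝔸 p ⇒ 𝔸 q))
  𝔸T : MS4Axiom (𝔸 p ⇒ p)
  𝔸4 : MS4Axiom (𝔸 p ⇒ 𝔸 (𝔸 p))
  𝔸5 : MS4Axiom (𝔼 p ⇒ 𝔸 (𝔼 p))
  lc : MS4Axiom (□ (𝔸 p) ⇒ 𝔸 (□ p))

data MS4+_⊢_ (Γ : CForm → Set) : CForm → Set where
  taut  : ∀ {φ} → Tautology φ → MS4+ Γ ⊢ φ
  ms4   : ∀ {φ} → MS4Axiom φ → MS4+ Γ ⊢ φ
  extra : ∀ {φ} → Γ φ → MS4+ Γ ⊢ φ
  mp    : ∀ {φ ψ} → MS4+ Γ ⊢ (φ ⇒ ψ) → MS4+ Γ ⊢ φ → MS4+ Γ ⊢ ψ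
  sub   : ∀ {φ} (σ : ℕ → CForm) → MS4+ Γ ⊢ φ → MS4+ Γ ⊢ subst σ φ
  nec□  : ∀ {φ} → MS4+ Γ ⊢ φ → MS4+ Γ ⊢ □ φ
  nec𝔸  : ∀ {φ} → MS4+ Γ ⊢ φ → MS4+ Γ ⊢ 𝔸 φ

-- Union of axiom sets; MS4+Γ₁ ∨ MS4+Γ₂ = MS4 + (Γ₁ ∪ Γ₂)
_∪_ : (CForm → Set) → (CForm → Set) → (CForm → Set)
(Γ₁ ∪ Γ₂) φ = Γ₁ φ ⊎ Γ₂ φ

_≐_ : (CForm → Set) → (CForm → Set) → Set
Γ₁ ≐ Γ₂ = (φ : CForm) → (MS4+ Γ₁ ⊢ φ → MS4+ Γ₂ ⊢ φ) × (MS4+ Γ₂ ⊢ φ → MS4+ Γ₁ ⊢ φ)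

⟦_⟧ : CForm → (CForm → Set)
⟦ ψ ⟧ φ = φ ≡ ψ

_ᵗ : IForm → CForm
varᵢ n ᵗ = □ (var n)
⊥ᵢ ᵗ = ⊥'
(φ ∧ᵢ ψ) ᵗ = (φ ᵗ) ∧' (ψ ᵗ)
(φ ∨ᵢ ψ) ᵗ = (φ ᵗ) ∨' (ψ ᵗ)
(φ ⇒ᵢ ψ) ᵗ = □ ((¬' (φ ᵗ)) ∨' (ψ ᵗ))
Aᵢ φ ᵗ = □ (𝔸 (φ ᵗ))
Eᵢ φ ᵗ = 𝔼 (φ ᵗ)

Grz-ax : CForm → Set
Grz-ax = ⟦ □ (□ (p ⇒ □ p) ⇒ p) ⇒ p ⟧

LKur-ax : CForm → Set
LKur-ax = ⟦ □ (𝔸 (◇ (□ p))) ⇒ ◇ (𝔸 p) ⟧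

N-ax : CForm → Set
N-ax = ⟦ □ (𝔼 p) ⇒ ◇ (𝔼 (□ p)) ⟧

GKur-ax : CForm → Set
GKur-ax φ = Σ IForm (λ ψ → (Kur⊢ ψ) × (ψ ᵗ ≡ φ))

MGrz∨GKur MGrz∨LKur MGrz∨N : CForm → Set
MGrz∨GKur = Grz-ax ∪ GKur-ax
MGrz∨LKur = Grz-ax ∪ LKur-ax
MGrz∨N    = Grz-ax ∪ N-ax

-- Grz proves the McKinsey axiom □◇a → ◇□a. Under the Gödel translation
-- ¬¬ becomes □◇, so the translation of Kuroda's axiom ∀¬¬p → ¬¬∀p reads
-- □∀□◇□p → □◇□∀□p; swapping □◇ for ◇□ by McKinsey turns it into LKur and
-- back. N is the dual of LKur at ¬p, the duality again needing McKinsey in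
-- one direction. Finally the translation of every MIPC theorem is an MS4
-- theorem, so all of GKur already follows from the translated Kuroda axiom.
module Submission where

open import Defs
open import Data.Bool using (Bool; true; false; _∧_; _∨_; not; T)
open import Data.Bool.Properties using (T-≡; T-∧)
open import Data.Fin using (Fin; zero; suc)
open import Data.Nat using (ℕ; zero; suc)
open import Data.Product using (_×_; _,_; proj₁; proj₂; swap; zip′) renaming (map to map×)
open import Data.Sum using (inj₁; inj₂)
open import Data.Vec using (Vec; []; _∷_; lookup; map)
open import Data.Vec.Properties using (lookup-map)
open import Function using (const; _∘_)
open import Function.Bundles using (Equivalence)
open import Relation.Binary.PropositionalEquality using (_≡_; refl; sym; trans; cong₂)

GrzAxiom McKinseyAxiom LKurAxiom NAxiom : CForm → CForm
GrzAxiom a = □ (□ (a ⇒ □ a) ⇒ a) ⇒ a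
McKinseyAxiom a = □ (◇ a) ⇒ ◇ (□ a)
LKurAxiom a = □ (𝔸 (◇ (□ a))) ⇒ ◇ (𝔸 a)
NAxiom a = □ (𝔼 a) ⇒ ◇ (𝔼 (□ a))

kurAxiom : IForm
kurAxiom = Aᵢ (¬ᵢ ¬ᵢ pᵢ) ⇒ᵢ ¬ᵢ ¬ᵢ Aᵢ pᵢ

-- Tautologies are certified by reflection: a propositional schema is
-- evaluated under all Boolean valuations of its metavariables.

infixr 5 _⟶_
infixl 7 _&_
infixl 6 _∣_

data Schema (n : ℕ) : Set where
  meta        : Fin n → Schema n
  ff          : Schema n
  _&_ _∣_ _⟶_ : Schema n → Schema n → Schema n

infix 9 ~_
~_ : ∀ {n} → Schema n → Schema n
~ φ = φ ⟶ ff

v₀ : ∀ {n} → Schema (suc n)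
v₀ = meta zero
v₁ : ∀ {n} → Schema (suc (suc n))
v₁ = meta (suc zero)
v₂ : ∀ {n} → Schema (suc (suc (suc n)))
v₂ = meta (suc (suc zero))
v₃ : ∀ {n} → Schema (suc (suc (suc (suc n))))
v₃ = meta (suc (suc (suc zero)))

instantiate : ∀ {n} → Schema n → Vec CForm n → CForm
instantiate (meta i) ρ = lookup ρ i
instantiate ff      ρ = ⊥'
instantiate (φ & ψ) ρ = instantiate φ ρ ∧' instantiate ψ ρ
instantiate (φ ∣ ψ) ρ = instantiate φ ρ ∨' instantiate ψ ρ
instantiate (φ ⟶ ψ) ρ = instantiate φ ρ ⇒ instantiate ψ ρ

evalSchema : ∀ {n} → Vec Bool n → Schema n → Bool
evalSchema b (meta i) = lookup b i
evalSchema b ff      = false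
evalSchema b (φ & ψ) = evalSchema b φ ∧ evalSchema b ψ
evalSchema b (φ ∣ ψ) = evalSchema b φ ∨ evalSchema b ψ
evalSchema b (φ ⟶ ψ) = not (evalSchema b φ) ∨ evalSchema b ψ

eval-instantiate : ∀ {n} v (φ : Schema n) ρ →
                   eval v (instantiate φ ρ) ≡ evalSchema (map (eval v) ρ) φ
eval-instantiate v (meta i) ρ = sym (lookup-map i (eval v) ρ)
eval-instantiate v ff      ρ = refl
eval-instantiate v (φ & ψ) ρ = cong₂ _∧_ (eval-instantiate v φ ρ) (eval-instantiate v ψ ρ)
eval-instantiate v (φ ∣ ψ) ρ = cong₂ _∨_ (eval-instantiate v φ ρ) (eval-instantiate v ψ ρ)
eval-instantiate v (φ ⟶ ψ) ρ =
  cong₂ (λ x y → not x ∨ y) (eval-instantiate v φ ρ) (eval-instantiate v ψ ρ)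

allVectors : (n : ℕ) → (Vec Bool n → Bool) → Bool
allVectors zero    f = f []
allVectors (suc n) f = allVectors n (f ∘ (true ∷_)) ∧ allVectors n (f ∘ (false ∷_))

allVectors-sound : ∀ n f → T (allVectors n f) → ∀ b → T (f b)
allVectors-sound zero    f t [] = t
allVectors-sound (suc n) f t (true ∷ b) =
  allVectors-sound n _ (proj₁ (Equivalence.to T-∧ t)) b
allVectors-sound (suc n) f t (false ∷ b) =
  allVectors-sound n _ (proj₂ (Equivalence.to (T-∧ {allVectors n (f ∘ (true ∷_))}) t)) b

IsTautology : ∀ {n} → Schema n → Set
IsTautology {n} φ = T (allVectors n (λ b → evalSchema b φ))

instantiate-tautology : ∀ {n} (φ : Schema n) ρ → IsTautology φ →
                        Tautology (instantiate φ ρ)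
instantiate-tautology φ ρ t v =
  trans (eval-instantiate v φ ρ)
        (Equivalence.to T-≡ (allVectors-sound _ _ t (map (eval v) ρ)))

module Derivations (Γ : CForm → Set) where

  infix 1 ⊢_
  ⊢_ : CForm → Set
  ⊢ φ = MS4+ Γ ⊢ φ

  -- For a tautological schema the implicit argument reduces to ⊤ and is filled in by Agda.
  tautology : ∀ {n} (φ : Schema n) ρ → {IsTautology φ} → ⊢ instantiate φ ρ
  tautology φ ρ {t} = taut (instantiate-tautology φ ρ t)

  private variable
    a b c d : CForm

  infixr 4 _⨾_
  _⨾_ : ⊢ a ⇒ b → ⊢ b ⇒ c → ⊢ a ⇒ c
  _⨾_ {a} {b} {c} f g =
    mp (mp (tautology ((v₀ ⟶ v₁) ⟶ (v₁ ⟶ v₂) ⟶ v₀ ⟶ v₂) (a ∷ b ∷ c ∷ [])) f) g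

  ⇒-refl : ⊢ a ⇒ a
  ⇒-refl {a} = tautology (v₀ ⟶ v₀) (a ∷ [])

  ∧-fst : ⊢ a ∧' b ⇒ a
  ∧-fst {a} {b} = tautology (v₀ & v₁ ⟶ v₀) (a ∷ b ∷ [])

  ∧-snd : ⊢ a ∧' b ⇒ b
  ∧-snd {a} {b} = tautology (v₀ & v₁ ⟶ v₁) (a ∷ b ∷ [])

  ∨-inl : ⊢ a ⇒ a ∨' b
  ∨-inl {a} {b} = tautology (v₀ ⟶ v₀ ∣ v₁) (a ∷ b ∷ [])

  ∨-inr : ⊢ b ⇒ a ∨' b
  ∨-inr {b} {a} = tautology (v₁ ⟶ v₀ ∣ v₁) (a ∷ b ∷ [])

  ¬¬-intro : ⊢ a ⇒ ¬' ¬' a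
  ¬¬-intro {a} = tautology (v₀ ⟶ ~ ~ v₀) (a ∷ [])

  ¬¬-elim : ⊢ ¬' ¬' a ⇒ a
  ¬¬-elim {a} = tautology (~ ~ v₀ ⟶ v₀) (a ∷ [])

  ⊥-elim : ⊢ ⊥' ⇒ a
  ⊥-elim {a} = tautology (ff ⟶ v₀) (a ∷ [])

  ⊢-∧ : ⊢ a → ⊢ b → ⊢ a ∧' b
  ⊢-∧ {a} {b} x y = mp (mp (tautology (v₀ ⟶ v₁ ⟶ v₀ & v₁) (a ∷ b ∷ [])) x) y

  contraposition : ⊢ a ⇒ b → ⊢ ¬' b ⇒ ¬' a
  contraposition {a} {b} f = mp (tautology ((v₀ ⟶ v₁) ⟶ ~ v₁ ⟶ ~ v₀) (a ∷ b ∷ [])) f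

  ⇒-curry : ⊢ a ∧' b ⇒ c → ⊢ a ⇒ b ⇒ c
  ⇒-curry {a} {b} {c} f =
    mp (tautology ((v₀ & v₁ ⟶ v₂) ⟶ v₀ ⟶ v₁ ⟶ v₂) (a ∷ b ∷ c ∷ [])) f

  ¬-intro : ⊢ a ⇒ b → ⊢ a ⇒ ¬' b → ⊢ ¬' a
  ¬-intro {a} {b} f g =
    mp (mp (tautology ((v₀ ⟶ v₁) ⟶ (v₀ ⟶ ~ v₁) ⟶ ~ v₀) (a ∷ b ∷ [])) f) g

  ∧-intro : ⊢ a ⇒ b → ⊢ a ⇒ c → ⊢ a ⇒ b ∧' c
  ∧-intro {a} {b} {c} f g =
    mp (mp (tautology ((v₀ ⟶ v₁) ⟶ (v₀ ⟶ v₂) ⟶ v₀ ⟶ v₁ & v₂) (a ∷ b ∷ c ∷ [])) f) g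

  ∨-elim : ⊢ a ⇒ c → ⊢ b ⇒ c → ⊢ a ∨' b ⇒ c
  ∨-elim {a} {c} {b} f g =
    mp (mp (tautology ((v₀ ⟶ v₂) ⟶ (v₁ ⟶ v₂) ⟶ v₀ ∣ v₁ ⟶ v₂) (a ∷ b ∷ c ∷ [])) f) g

  ∧-map : ⊢ a ⇒ b → ⊢ c ⇒ d → ⊢ a ∧' c ⇒ b ∧' d
  ∧-map f g = ∧-intro (∧-fst ⨾ f) (∧-snd ⨾ g)

  ∨-map : ⊢ a ⇒ b → ⊢ c ⇒ d → ⊢ a ∨' c ⇒ b ∨' d
  ∨-map f g = ∨-elim (f ⨾ ∨-inl) (g ⨾ ∨-inr)

  □-K : ∀ a b → ⊢ □ (a ⇒ b) ⇒ □ a ⇒ □ b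
  □-K a b = sub (λ { zero → a ; (suc _) → b }) (ms4 □K)

  □-T : ∀ a → ⊢ □ a ⇒ a
  □-T a = sub (const a) (ms4 □T)

  □-4 : ∀ a → ⊢ □ a ⇒ □ (□ a)
  □-4 a = sub (const a) (ms4 □4)

  𝔸-K : ∀ a b → ⊢ 𝔸 (a ⇒ b) ⇒ 𝔸 a ⇒ 𝔸 b
  𝔸-K a b = sub (λ { zero → a ; (suc _) → b }) (ms4 𝔸K)

  𝔸-T : ∀ a → ⊢ 𝔸 a ⇒ a
  𝔸-T a = sub (const a) (ms4 𝔸T)

  𝔸-4 : ∀ a → ⊢ 𝔸 a ⇒ 𝔸 (𝔸 a)
  𝔸-4 a = sub (const a) (ms4 𝔸4)

  𝔸-5 : ∀ a → ⊢ 𝔼 a ⇒ 𝔸 (𝔼 a)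
  𝔸-5 a = sub (const a) (ms4 𝔸5)

  □𝔸⇒𝔸□ : ∀ a → ⊢ □ (𝔸 a) ⇒ 𝔸 (□ a)
  □𝔸⇒𝔸□ a = sub (const a) (ms4 lc)

  module NormalModality (M : CForm → CForm)
                        (nec : ∀ {a} → ⊢ a → ⊢ M a)
                        (K : ∀ a b → ⊢ M (a ⇒ b) ⇒ M a ⇒ M b) where

    mono : ⊢ a ⇒ b → ⊢ M a ⇒ M b
    mono {a} {b} f = mp (K a b) (nec f)

    dual-mono : ⊢ a ⇒ b → ⊢ ¬' M (¬' a) ⇒ ¬' M (¬' b)
    dual-mono f = contraposition (mono (contraposition f))

    ∧-distrib : ∀ a b → ⊢ M a ∧' M b ⇒ M (a ∧' b)
    ∧-distrib a b =
      mp (mp (tautology ((v₀ ⟶ v₁) ⟶ (v₁ ⟶ v₂ ⟶ v₃) ⟶ v₀ & v₂ ⟶ v₃)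
                        (M a ∷ M (b ⇒ a ∧' b) ∷ M b ∷ M (a ∧' b) ∷ []))
             (mono (⇒-curry ⇒-refl)))
         (K b (a ∧' b))

  open NormalModality □ nec□ □-K public
    renaming (mono to □-mono; dual-mono to ◇-mono; ∧-distrib to □-∧)
  open NormalModality 𝔸 nec𝔸 𝔸-K public
    renaming (mono to 𝔸-mono; dual-mono to 𝔼-mono; ∧-distrib to 𝔸-∧)

  □𝔸⇒□𝔸□ : ∀ a → ⊢ □ (𝔸 a) ⇒ □ (𝔸 (□ a))
  □𝔸⇒□𝔸□ a = □-4 (𝔸 a) ⨾ □-mono (□𝔸⇒𝔸□ a)

  ¬□⇒◇¬ : ⊢ ¬' □ a ⇒ ◇ (¬' a)
  ¬□⇒◇¬ = contraposition (□-mono ¬¬-elim)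

  ◇¬⇒¬□ : ⊢ ◇ (¬' a) ⇒ ¬' □ a
  ◇¬⇒¬□ = contraposition (□-mono ¬¬-intro)

  ¬𝔸⇒𝔼¬ : ⊢ ¬' 𝔸 a ⇒ 𝔼 (¬' a)
  ¬𝔸⇒𝔼¬ = contraposition (𝔸-mono ¬¬-elim)

  𝔼¬⇒¬𝔸 : ⊢ 𝔼 (¬' a) ⇒ ¬' 𝔸 a
  𝔼¬⇒¬𝔸 = contraposition (𝔸-mono ¬¬-intro)

  𝔼-intro : ∀ a → ⊢ a ⇒ 𝔼 a
  𝔼-intro a = ¬¬-intro ⨾ contraposition (𝔸-T (¬' a))

  𝔼-∨ : ∀ a b → ⊢ 𝔼 (a ∨' b) ⇒ 𝔼 a ∨' 𝔼 b
  𝔼-∨ a b =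
    mp (tautology ((v₀ & v₁ ⟶ v₂) ⟶ ~ v₂ ⟶ ~ v₀ ∣ ~ v₁)
                  (𝔸 (¬' a) ∷ 𝔸 (¬' b) ∷ 𝔸 (¬' (a ∨' b)) ∷ []))
       (𝔸-∧ _ _ ⨾ 𝔸-mono (tautology (~ v₀ & ~ v₁ ⟶ ~ (v₀ ∣ v₁)) (a ∷ b ∷ [])))

  𝔸∧𝔼⇒𝔼∧ : ∀ a b → ⊢ 𝔸 a ∧' 𝔼 b ⇒ 𝔼 (a ∧' b)
  𝔸∧𝔼⇒𝔼∧ a b =
    mp (tautology ((v₀ & v₂ ⟶ v₁) ⟶ v₀ & ~ v₁ ⟶ ~ v₂)
                  (𝔸 a ∷ 𝔸 (¬' b) ∷ 𝔸 (¬' (a ∧' b)) ∷ []))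
       (𝔸-∧ _ _ ⨾ 𝔸-mono (tautology (v₀ & ~ (v₀ & v₁) ⟶ ~ v₁) (a ∷ b ∷ [])))

  ¬𝔸⇒𝔸¬𝔸 : ∀ a → ⊢ ¬' 𝔸 a ⇒ 𝔸 (¬' 𝔸 a)
  ¬𝔸⇒𝔸¬𝔸 a = ¬𝔸⇒𝔼¬ ⨾ 𝔸-5 (¬' a) ⨾ 𝔸-mono 𝔼¬⇒¬𝔸

  𝔼𝔸⇒𝔸 : ∀ a → ⊢ 𝔼 (𝔸 a) ⇒ 𝔸 a
  𝔼𝔸⇒𝔸 a = contraposition (¬𝔸⇒𝔸¬𝔸 a) ⨾ ¬¬-elim

  𝔼-elim : ⊢ a ⇒ 𝔸 a → ⊢ 𝔼 a ⇒ a
  𝔼-elim {a} f = 𝔼-mono f ⨾ 𝔼𝔸⇒𝔸 a ⨾ 𝔸-T a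

  𝔼□⇒□𝔼 : ∀ a → ⊢ 𝔼 (□ a) ⇒ □ (𝔼 a)
  𝔼□⇒□𝔼 a = 𝔼-mono (□-mono (𝔼-intro a)) ⨾ 𝔼-elim (□-mono (𝔸-5 a) ⨾ □𝔸⇒𝔸□ (𝔼 a))

  strict-intro : ⊢ a ⇒ b → ⊢ □ (¬' a ∨' b)
  strict-intro {a} {b} f = nec□ (mp (tautology ((v₀ ⟶ v₁) ⟶ ~ v₀ ∣ v₁) (a ∷ b ∷ [])) f)

  strict-elim : ⊢ □ (¬' a ∨' b) → ⊢ a ⇒ b
  strict-elim {a} {b} f = mp (tautology ((~ v₀ ∣ v₁) ⟶ v₀ ⟶ v₁) (a ∷ b ∷ [])) (mp (□-T _) f)

  strict-curry : ⊢ a ⇒ □ a → ⊢ a ∧' b ⇒ c → ⊢ a ⇒ □ (¬' b ∨' c)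
  strict-curry {a} {b} {c} persistent f =
    persistent ⨾ □-mono (mp (tautology ((v₀ & v₁ ⟶ v₂) ⟶ v₀ ⟶ ~ v₁ ∣ v₂) (a ∷ b ∷ c ∷ [])) f)

  strict-map : ⊢ c ⇒ a → ⊢ b ⇒ d → ⊢ □ (¬' a ∨' b) ⇒ □ (¬' c ∨' d)
  strict-map f g = □-mono (∨-map (contraposition f) g)

  module _ (grz : ∀ a → ⊢ GrzAxiom a) where

    -- Under □◇a ∧ □◇¬a, which is persistent, the premise □(a → □a) of Grz
    -- fails, so Grz yields a and hence □a, contradicting ◇¬a.
    mckinsey : ∀ a → ⊢ McKinseyAxiom a
    mckinsey a = ⇒-curry ◇a-and-◇¬a-absurd ⨾ contraposition (□-mono ¬□⇒◇¬)
      where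
      both : CForm
      both = □ (◇ a) ∧' □ (◇ (¬' a))

      both-persistent : ⊢ both ⇒ □ both
      both-persistent = ∧-map (□-4 _) (□-4 _) ⨾ □-∧ _ _

      both-refutes-□[a⇒□a] : ⊢ both ⇒ ¬' □ (a ⇒ □ a)
      both-refutes-□[a⇒□a] = ⇒-curry (¬-intro {b = □ (¬' a)}
        (∧-intro ∧-snd (∧-fst ⨾ ∧-snd) ⨾ □-∧ _ _ ⨾
         □-mono (∧-map ⇒-refl ◇¬⇒¬□ ⨾ tautology ((v₀ ⟶ v₁) & ~ v₁ ⟶ ~ v₀) (a ∷ □ a ∷ [])))
        (∧-fst ⨾ ∧-fst ⨾ □-T (◇ a)))

      both⇒a : ⊢ both ⇒ a
      both⇒a = both-persistent ⨾
               □-mono (both-refutes-□[a⇒□a] ⨾ tautology (~ v₀ ⟶ v₀ ⟶ v₁) (□ (a ⇒ □ a) ∷ a ∷ [])) ⨾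
               grz a

      ◇a-and-◇¬a-absurd : ⊢ ¬' both
      ◇a-and-◇¬a-absurd = ¬-intro (both-persistent ⨾ □-mono both⇒a) (∧-snd ⨾ □-T _ ⨾ ◇¬⇒¬□)

  ᵗ-persistent : ∀ φ → ⊢ φ ᵗ ⇒ □ (φ ᵗ)
  ᵗ-persistent (varᵢ n) = □-4 (var n)
  ᵗ-persistent ⊥ᵢ       = ⊥-elim
  ᵗ-persistent (φ ∧ᵢ ψ) = ∧-map (ᵗ-persistent φ) (ᵗ-persistent ψ) ⨾ □-∧ _ _
  ᵗ-persistent (φ ∨ᵢ ψ) = ∨-elim (ᵗ-persistent φ ⨾ □-mono ∨-inl) (ᵗ-persistent ψ ⨾ □-mono ∨-inr)
  ᵗ-persistent (φ ⇒ᵢ ψ) = □-4 _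
  ᵗ-persistent (Aᵢ φ)   = □-4 _
  ᵗ-persistent (Eᵢ φ)   = 𝔼-mono (ᵗ-persistent φ) ⨾ 𝔼□⇒□𝔼 (φ ᵗ)

  infix 2 _⟺_
  _⟺_ : CForm → CForm → Set
  a ⟺ b = (⊢ a ⇒ b) × (⊢ b ⇒ a)

  -- Substituting into the translation produces □(σ n)ᵗ where the translated
  -- substitution instance has (σ n)ᵗ; persistence bridges the gap.
  ᵗ-subst : ∀ σ φ → subst (λ n → σ n ᵗ) (φ ᵗ) ⟺ substᵢ σ φ ᵗ
  ᵗ-subst σ (varᵢ n) = □-T _ , ᵗ-persistent (σ n)
  ᵗ-subst σ ⊥ᵢ       = ⇒-refl , ⇒-refl
  ᵗ-subst σ (φ ∧ᵢ ψ) = zip′ ∧-map ∧-map (ᵗ-subst σ φ) (ᵗ-subst σ ψ)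
  ᵗ-subst σ (φ ∨ᵢ ψ) = zip′ ∨-map ∨-map (ᵗ-subst σ φ) (ᵗ-subst σ ψ)
  ᵗ-subst σ (φ ⇒ᵢ ψ) = zip′ strict-map strict-map (swap (ᵗ-subst σ φ)) (ᵗ-subst σ ψ)
  ᵗ-subst σ (Aᵢ φ)   = map× (□-mono ∘ 𝔸-mono) (□-mono ∘ 𝔸-mono) (ᵗ-subst σ φ)
  ᵗ-subst σ (Eᵢ φ)   = map× 𝔼-mono 𝔼-mono (ᵗ-subst σ φ)

  ipc-axiomᵗ : ∀ {φ} → IPCAxiom φ → ⊢ φ ᵗ
  ipc-axiomᵗ (ax-K a b)   = strict-intro (strict-curry (ᵗ-persistent a) ∧-fst)
  ipc-axiomᵗ (ax-S a b c) = strict-intro (strict-curry (□-4 _) (□-∧ _ _ ⨾ □-mono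
    (mp (tautology ((v₃ ⟶ ~ v₁ ∣ v₂) ⟶ (~ v₀ ∣ v₃) & (~ v₀ ∣ v₁) ⟶ ~ v₀ ∣ v₂)
                   (a ᵗ ∷ b ᵗ ∷ c ᵗ ∷ □ (¬' (b ᵗ) ∨' c ᵗ) ∷ []))
        (□-T _))))
  ipc-axiomᵗ (ax-∧E₁ a b) = strict-intro ∧-fst
  ipc-axiomᵗ (ax-∧E₂ a b) = strict-intro ∧-snd
  ipc-axiomᵗ (ax-∧I a b)  = strict-intro (strict-curry (ᵗ-persistent a) ⇒-refl)
  ipc-axiomᵗ (ax-∨I₁ a b) = strict-intro ∨-inl
  ipc-axiomᵗ (ax-∨I₂ a b) = strict-intro ∨-inr
  ipc-axiomᵗ (ax-∨E a b c) = strict-intro (strict-curry (□-4 _) (□-∧ _ _ ⨾ □-mono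
    (tautology ((~ v₀ ∣ v₂) & (~ v₁ ∣ v₂) ⟶ ~ (v₀ ∣ v₁) ∣ v₂) (a ᵗ ∷ b ᵗ ∷ c ᵗ ∷ []))))
  ipc-axiomᵗ (ax-⊥E a)    = strict-intro ⊥-elim

  mipc-axiomᵗ : ∀ {φ} → MIPCAxiom φ → ⊢ φ ᵗ
  mipc-axiomᵗ m1 = ⊢-∧ (strict-intro (∧-intro (□-mono (𝔸-mono ∧-fst)) (□-mono (𝔸-mono ∧-snd))))
                       (strict-intro (□-∧ _ _ ⨾ □-mono (𝔸-∧ _ _)))
  mipc-axiomᵗ m2 = strict-intro (□-T _ ⨾ 𝔸-T _)
  mipc-axiomᵗ m3 = strict-intro (□-mono (𝔸-4 _) ⨾ □𝔸⇒□𝔸□ _)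
  mipc-axiomᵗ m4 = ⊢-∧ (strict-intro (𝔼-∨ _ _)) (strict-intro (∨-elim (𝔼-mono ∨-inl) (𝔼-mono ∨-inr)))
  mipc-axiomᵗ m5 = strict-intro (𝔼-intro _)
  mipc-axiomᵗ m6 = strict-intro (𝔼-elim (𝔸-5 _))
  mipc-axiomᵗ m7 = strict-intro (∧-map (𝔸-5 _) ⇒-refl ⨾ 𝔸∧𝔼⇒𝔼∧ _ _)
  mipc-axiomᵗ m8 = strict-intro (𝔼-elim (□-mono (𝔸-4 _) ⨾ □𝔸⇒𝔸□ _))
  mipc-axiomᵗ m9 = strict-intro (ᵗ-persistent (Eᵢ pᵢ) ⨾ □-mono (𝔸-5 _))

  Kur-translation : ⊢ kurAxiom ᵗ → ∀ {φ} → Kur⊢ φ → ⊢ φ ᵗ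
  Kur-translation k (ipc ax)    = ipc-axiomᵗ ax
  Kur-translation k (mipc ax)   = mipc-axiomᵗ ax
  Kur-translation k kur         = k
  Kur-translation k (mp f x)    = mp (strict-elim (Kur-translation k f)) (Kur-translation k x)
  Kur-translation k (sub {φ} σ x) =
    mp (proj₁ (ᵗ-subst σ φ)) (sub (λ n → σ n ᵗ) (Kur-translation k x))
  Kur-translation k (nec∀ x)    = nec□ (nec𝔸 (Kur-translation k x))

  -- (¬ᵢ φ)ᵗ is ¬ᵗ (φ ᵗ).
  ¬ᵗ : CForm → CForm
  ¬ᵗ a = □ (¬' a ∨' ⊥')

  ¬ᵗ⇒□¬ : ⊢ ¬ᵗ a ⇒ □ (¬' a)
  ¬ᵗ⇒□¬ {a} = □-mono (tautology (~ v₀ ∣ ff ⟶ ~ v₀) (a ∷ []))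

  □¬⇒¬ᵗ : ⊢ □ (¬' a) ⇒ ¬ᵗ a
  □¬⇒¬ᵗ {a} = □-mono (tautology (~ v₀ ⟶ ~ v₀ ∣ ff) (a ∷ []))

  ¬ᵗ¬ᵗ⇒□◇ : ⊢ ¬ᵗ (¬ᵗ a) ⇒ □ (◇ a)
  ¬ᵗ¬ᵗ⇒□◇ = ¬ᵗ⇒□¬ ⨾ □-mono (contraposition □¬⇒¬ᵗ)

  □◇⇒¬ᵗ¬ᵗ : ⊢ □ (◇ a) ⇒ ¬ᵗ (¬ᵗ a)
  □◇⇒¬ᵗ¬ᵗ = □-mono (contraposition ¬ᵗ⇒□¬) ⨾ □¬⇒¬ᵗ

  LKur-from-N : (∀ a → ⊢ NAxiom a) → ∀ a → ⊢ LKurAxiom a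
  LKur-from-N n a =
    □-mono (𝔸-mono (◇-mono (□-T a)) ⨾ ¬¬-intro) ⨾ ¬¬-intro ⨾
    contraposition (n (¬' a)) ⨾ contraposition (□-mono ¬𝔸⇒𝔼¬)

  module _ (mck : ∀ a → ⊢ McKinseyAxiom a) where

    kurᵗ-from-LKur : (∀ a → ⊢ LKurAxiom a) → ⊢ kurAxiom ᵗ
    kurᵗ-from-LKur lkur = strict-intro
      (□-mono (𝔸-mono ¬ᵗ¬ᵗ⇒□◇) ⨾ □-4 _ ⨾ □-mono □𝔸□◇□⇒◇𝔸□ ⨾ □-4 _ ⨾ □-mono (mck _) ⨾ □◇⇒¬ᵗ¬ᵗ)
      where
      □𝔸□◇□⇒◇𝔸□ : ⊢ □ (𝔸 (□ (◇ (□ p)))) ⇒ ◇ (𝔸 (□ p))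
      □𝔸□◇□⇒◇𝔸□ = □-mono (𝔸-mono (□-T _ ⨾ ◇-mono (□-4 p))) ⨾ lkur (□ p)

    LKur-from-kurᵗ : ⊢ kurAxiom ᵗ → ∀ a → ⊢ LKurAxiom a
    LKur-from-kurᵗ k a = sub (const a) LKur-p
      where
      LKur-p : ⊢ LKurAxiom p
      LKur-p = □𝔸⇒□𝔸□ _ ⨾ □-mono (𝔸-mono □◇⇒¬ᵗ¬ᵗ) ⨾ strict-elim k ⨾ ¬ᵗ¬ᵗ⇒□◇ ⨾
               mck _ ⨾ ◇-mono (□-T _ ⨾ □-T _ ⨾ 𝔸-mono (□-T p))

    N-from-LKur : (∀ a → ⊢ LKurAxiom a) → ∀ a → ⊢ NAxiom a
    N-from-LKur lkur a = ¬¬-intro ⨾ contraposition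
      (□-mono ¬¬-elim ⨾ □𝔸⇒□𝔸□ _ ⨾ □-mono (𝔸-mono (□-mono ¬□⇒◇¬ ⨾ mck (¬' a))) ⨾
       lkur (¬' a))

⊢-lift : ∀ {Γ Δ} → (∀ {φ} → Γ φ → MS4+ Δ ⊢ φ) → ∀ {φ} → MS4+ Γ ⊢ φ → MS4+ Δ ⊢ φ
⊢-lift h (taut t)  = taut t
⊢-lift h (ms4 ax)  = ms4 ax
⊢-lift h (extra x) = h x
⊢-lift h (mp f x)  = mp (⊢-lift h f) (⊢-lift h x)
⊢-lift h (sub σ x) = sub σ (⊢-lift h x)
⊢-lift h (nec□ x)  = nec□ (⊢-lift h x)
⊢-lift h (nec𝔸 x)  = nec𝔸 (⊢-lift h x)

≐-intro : ∀ {Γ Δ} → (∀ {φ} → Γ φ → MS4+ Δ ⊢ φ) → (∀ {φ} → Δ φ → MS4+ Γ ⊢ φ) → Γ ≐ Δ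
≐-intro f g φ = ⊢-lift f , ⊢-lift g

∪-derivableʳ : ∀ {Γ Δ Δ′} → (∀ {φ} → Δ φ → MS4+ (Γ ∪ Δ′) ⊢ φ) →
               ∀ {φ} → (Γ ∪ Δ) φ → MS4+ (Γ ∪ Δ′) ⊢ φ
∪-derivableʳ h (inj₁ x) = extra (inj₁ x)
∪-derivableʳ h (inj₂ x) = h x

axiomˡ : ∀ {ψ Δ} a → MS4+ (⟦ ψ ⟧ ∪ Δ) ⊢ subst (const a) ψ
axiomˡ a = sub (const a) (extra (inj₁ refl))

axiomʳ : ∀ {Γ ψ} a → MS4+ (Γ ∪ ⟦ ψ ⟧) ⊢ subst (const a) ψ
axiomʳ a = sub (const a) (extra (inj₂ refl))

GKur⊆MGrz∨LKur : ∀ {φ} → GKur-ax φ → MS4+ MGrz∨LKur ⊢ φ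
GKur⊆MGrz∨LKur (ψ , d , refl) = Kur-translation (kurᵗ-from-LKur (mckinsey axiomˡ) axiomʳ) d
  where open Derivations MGrz∨LKur

LKur⊆MGrz∨GKur : ∀ {φ} → LKur-ax φ → MS4+ MGrz∨GKur ⊢ φ
LKur⊆MGrz∨GKur refl = LKur-from-kurᵗ (mckinsey axiomˡ) (extra (inj₂ (kurAxiom , kur , refl))) p
  where open Derivations MGrz∨GKur

LKur⊆MGrz∨N : ∀ {φ} → LKur-ax φ → MS4+ MGrz∨N ⊢ φ
LKur⊆MGrz∨N refl = LKur-from-N axiomʳ p
  where open Derivations MGrz∨N

N⊆MGrz∨LKur : ∀ {φ} → N-ax φ → MS4+ MGrz∨LKur ⊢ φ
N⊆MGrz∨LKur refl = N-from-LKur (mckinsey axiomˡ) axiomʳ p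
  where open Derivations MGrz∨LKur

proposition5p10 : (MGrz∨GKur ≐ MGrz∨LKur) × (MGrz∨LKur ≐ MGrz∨N)
proposition5p10 =
  ≐-intro (∪-derivableʳ GKur⊆MGrz∨LKur) (∪-derivableʳ LKur⊆MGrz∨GKur) ,
  ≐-intro (∪-derivableʳ LKur⊆MGrz∨N) (∪-derivableʳ N⊆MGrz∨LKur)
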